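{- Let $\Sigma=\{a_1,a_2,c\}$ and let $L^{fa}=\bigcup_{m\in\mathbb{N}}\bigcup_{k<m}L_{k,m}$, where $L_{k,m}$ is the set of trees obtained from $t_c$ by grafting some tree $t'\in L_{\neg a_1\vee\neg a_2}$ at the node $l^k r$ and grafting $t_{a_1}$ at the node $l^m$. Then there is a finitely ambiguous PTA that accepts $L^{fa}$.
   Context: Trees: node set $\{l,r\}^*$; a $\Sigma$-labeled tree is $t:\{l,r\}^*\to\Sigma$; $t_\sigma$ is the tree with all nodes labeled $\sigma$; grafting $t_2$ at node $v$ of $t_1$ replaces the subtree of $t_1$ rooted at $v$ by $t_2$. $L_{\neg a_1\vee\neg a_2}$ is the set of $\Sigma$-labeled trees that have no $a_1$-labeled node or have no $a_2$-labeled node. A parity tree automaton (PTA) $\mathcal{A}=(Q,\Sigma,Q_I,\delta,\mathbb{C})$: computations $\phi:\{l,r\}^*\to Q$ with $\phi(\epsilon)\in Q_I$ and $(\phi(v),t(v),\phi(vl),\phi(vr))\in\delta$ for all $v$, accepting if along every branch the maximal color occurring infinitely often is even; it is finitely ambiguous if every tree has only finitely many accepting computations. -}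

module Defs where

open import Data.Nat using (ℕ; zero; suc; _≤_; _<_)
open import Data.Nat.Base using (_⊔_)
open import Data.Fin using (Fin)
open import Data.Bool using (Bool; true)
open import Data.List using (List; []; _∷_; replicate; _++_)
open import Data.Product using (Σ; ∃; _×_; _,_)
open import Data.Sum using (_⊎_)
open import Relation.Binary.PropositionalEquality using (_≡_; _≢_)
open import Relation.Nullary using (¬_)

data Dir : Set where
  l r : Dir

Node : Set
Node = List Dir

Tree : Set → Set
Tree A = Node → A

const-tree : {A : Set} → A → Tree A
const-tree σ _ = σ

_≈T_ : {A : Set} → Tree A → Tree A → Set
t ≈T s = ∀ v → t v ≡ s v

-- graft t₁ v t₂ : replace the subtree of t₁ rooted at v by t₂.
graft : {A : Set} → Tree A → Node → Tree A → Tree A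
graft t₁ [] t₂ w = t₂ w
graft t₁ (d ∷ u) t₂ [] = t₁ []
graft t₁ (l ∷ u) t₂ (l ∷ w) = graft (λ x → t₁ (l ∷ x)) u t₂ w
graft t₁ (l ∷ u) t₂ (r ∷ w) = t₁ (r ∷ w)
graft t₁ (r ∷ u) t₂ (l ∷ w) = t₁ (l ∷ w)
graft t₁ (r ∷ u) t₂ (r ∷ w) = graft (λ x → t₁ (r ∷ x)) u t₂ w

data Sym : Set where
  a₁ a₂ c : Sym

L¬a₁∨¬a₂ : Tree Sym → Set
L¬a₁∨¬a₂ t = (∀ v → t v ≢ a₁) ⊎ (∀ v → t v ≢ a₂)

lkr : ℕ → Node
lkr k = replicate k l ++ (r ∷ [])

lm : ℕ → Node
lm m = replicate m l

L[_,_] : ℕ → ℕ → Tree Sym → Set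
L[ k , m ] t = Σ (Tree Sym) λ t' → L¬a₁∨¬a₂ t' ×
  (t ≈T graft (graft (const-tree c) (lkr k) t') (lm m) (const-tree a₁))

Lfa : Tree Sym → Set
Lfa t = Σ ℕ λ m → Σ ℕ λ k → k < m × L[ k , m ] t

record PTA : Set where
  field
    nQ     : ℕ
    QI     : Fin nQ → Bool
    δ      : Fin nQ → Sym → Fin nQ → Fin nQ → Bool
    colour : Fin nQ → ℕ

module _ (𝒜 : PTA) where
  open PTA 𝒜

  Computation : Set
  Computation = Tree (Fin nQ)

  child : Node → Dir → Node
  child v d = v ++ (d ∷ [])

  IsComputation : Tree Sym → Computation → Set
  IsComputation t φ = QI (φ []) ≡ true ×
    (∀ v → δ (φ v) (t v) (φ (child v l)) (φ (child v r)) ≡ true)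

  Branch : Set
  Branch = ℕ → Dir

  prefix : Branch → ℕ → Node
  prefix β zero = []
  prefix β (suc n) = β zero ∷ prefix (λ i → β (suc i)) n

  data Even : ℕ → Set where
    ev0 : Even zero
    ev2 : ∀ {n} → Even n → Even (suc (suc n))

  -- The maximal colour occurring infinitely often along β is even:
  -- some even d occurs infinitely often and eventually all colours are ≤ d.
  ParityOK : Computation → Branch → Set
  ParityOK φ β = Σ ℕ λ d → Even d ×
    (∀ N → Σ ℕ λ n → N ≤ n × colour (φ (prefix β n)) ≡ d) ×
    (Σ ℕ λ N → ∀ n → N ≤ n → colour (φ (prefix β n)) ≤ d)

  Accepting : Tree Sym → Computation → Set
  Accepting t φ = IsComputation t φ × (∀ β → ParityOK φ β)

  Accepts : Tree Sym → Set
  Accepts t = Σ Computation (Accepting t)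

  FinitelyAmbiguous : Set
  FinitelyAmbiguous = ∀ t → ¬ (Σ (ℕ → Computation) λ f →
    (∀ i → Accepting t (f i)) × (∀ i j → i ≢ j → ¬ (f i ≈T f j)))

-- The automaton reads the tree along its left spine. In state `before` it guesses the
-- node l^k at which the right child l^k r carries the grafted tree, and checks that
-- this subtree avoids a₁ or avoids a₂ (guessing which one); below l^k it waits in
-- `after` and guesses the node l^m from which on everything is a₁. All other
-- subtrees are checked to be c-trees. Both spine states have colour 1, so on the
-- branch l^ω an accepting run must reach the a₁-subtree. Hence every accepting run
-- is fixed by its two guesses, the depth k and the avoided letter b, while m is
-- determined by the tree itself (l^m is the first a₁ on the spine); a tree thus has
-- at most 2m accepting runs, and infinitely many distinct ones would contradict the
-- pigeonhole principle.
module Submission where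

open import Defs
open import Data.Bool using (true)
open import Data.Empty using (⊥-elim)
open import Data.Fin as Fin using (Fin; toℕ; fromℕ<; combine)
open import Data.Fin.Properties using (_≟_; pigeonhole; combine-injective; toℕ-fromℕ<)
open import Data.List using ([]; _∷_; _++_; [_]; length)
open import Data.Nat using (ℕ; zero; suc; _≤_; _<_; _+_; _*_; z≤n; s≤s)
open import Data.Nat.Properties using (≤-antisym; ≮⇒≥; ≤-reflexive; m≤m+n; m≤n+m; n<1+n; <⇒≢)
open import Data.Product using (Σ; ∃; ∃₂; _×_; _,_; proj₁; proj₂)
open import Data.Sum using (_⊎_; inj₁; inj₂)
open import Function using (_∘_)
open import Function.Bundles using (_⇔_; mk⇔; Equivalence)
open import Relation.Binary.Definitions using (DecidableEquality)
open import Relation.Binary.PropositionalEquality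
  using (_≡_; _≢_; refl; sym; trans; cong; cong₂; subst; module ≡-Reasoning)
open import Relation.Nullary using (¬_; Dec; yes; no; does; ¬?)
open import Relation.Nullary.Decidable using (map′; _×-dec_; _⊎-dec_; dec-true)

does⇒ : {A : Set} (a? : Dec A) → does a? ≡ true → A
does⇒ (yes a) _ = a
does⇒ (no _) ()

pigeonholeℕ : ∀ {n} (f : ℕ → Fin n) → ∃₂ λ i j → i ≢ j × f i ≡ f j
pigeonholeℕ {n} f =
  let i , j , i<j , fi≡fj = pigeonhole (n<1+n n) (f ∘ toℕ)
  in toℕ i , toℕ j , <⇒≢ i<j , fi≡fj

≈T-node : {A : Set} {s s′ : Tree A} → s [] ≡ s′ [] →
  (s ∘ (l ∷_)) ≈T (s′ ∘ (l ∷_)) → (s ∘ (r ∷_)) ≈T (s′ ∘ (r ∷_)) → s ≈T s′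
≈T-node root _    _     []      = root
≈T-node _    left _     (l ∷ w) = left w
≈T-node _    _    right (r ∷ w) = right w

module _ (𝔅 : PTA) where
  open PTA 𝔅

  length-prefix : ∀ β n → length (prefix 𝔅 β n) ≡ n
  length-prefix β zero    = refl
  length-prefix β (suc n) = cong suc (length-prefix (β ∘ suc) n)

  prefix-left : ∀ n → prefix 𝔅 (λ _ → l) n ≡ lm n
  prefix-left zero    = refl
  prefix-left (suc n) = cong (l ∷_) (prefix-left n)

  accepting-resp-≈ : ∀ {t t′ φ} → t ≈T t′ → Accepting 𝔅 t′ φ → Accepting 𝔅 t φ
  accepting-resp-≈ {φ = φ} t≈t′ ((init , steps) , parity) =
    (init , λ v → subst (λ σ → δ (φ v) σ _ _ ≡ true) (sym (t≈t′ v)) (steps v)) , parity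

  colour-eventually-0⇒parity : ∀ {φ} m → (∀ v → m ≤ length v → colour (φ v) ≡ 0) →
    ∀ β → ParityOK 𝔅 φ β
  colour-eventually-0⇒parity {φ} m deep β =
    0 , ev0 , (λ N → N + m , m≤m+n N m , zero-at (m≤n+m m N)) ,
    (m , λ n m≤n → ≤-reflexive (zero-at m≤n))
    where
    zero-at : ∀ {n} → m ≤ n → colour (φ (prefix 𝔅 β n)) ≡ 0
    zero-at {n} m≤n = deep _ (subst (m ≤_) (sym (length-prefix β n)) m≤n)

  accepting⇒even-on-left-spine : ∀ {t φ} → Accepting 𝔅 t φ →
    ∃ λ n → Even 𝔅 (colour (φ (lm n)))
  accepting⇒even-on-left-spine {φ = φ} (_ , parity) with parity (λ _ → l)
  ... | d , even-d , often , _ with often 0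
  ... | n , _ , colour≡d =
    n , subst (λ v → Even 𝔅 (colour (φ v))) (prefix-left n)
              (subst (Even 𝔅) (sym colour≡d) even-d)

_≟ₛ_ : DecidableEquality Sym
a₁ ≟ₛ a₁ = yes refl
a₂ ≟ₛ a₂ = yes refl
c  ≟ₛ c  = yes refl
a₁ ≟ₛ a₂ = no λ ()
a₁ ≟ₛ c  = no λ ()
a₂ ≟ₛ a₁ = no λ ()
a₂ ≟ₛ c  = no λ ()
c  ≟ₛ a₁ = no λ ()
c  ≟ₛ a₂ = no λ ()

a₁≢c : a₁ ≢ c
a₁≢c ()

forbidden : Fin 2 → Sym
forbidden Fin.zero    = a₁
forbidden (Fin.suc _) = a₂

Avoids : Fin 2 → Tree Sym → Set
Avoids b t = ∀ v → t v ≢ forbidden b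

L¬a₁∨¬a₂⇔avoids : ∀ {t} → L¬a₁∨¬a₂ t ⇔ ∃ λ b → Avoids b t
L¬a₁∨¬a₂⇔avoids = mk⇔
  (λ { (inj₁ no-a₁) → Fin.zero , no-a₁ ; (inj₂ no-a₂) → Fin.suc Fin.zero , no-a₂ })
  (λ { (Fin.zero , av) → inj₁ av ; (Fin.suc Fin.zero , av) → inj₂ av })

Q : Set
Q = Fin 6

-- `before` and `after` are the left-spine states above resp. below the guessed node
-- l^k; the remaining states each check a whole subtree.
pattern before     = Fin.zero
pattern after      = Fin.suc Fin.zero
pattern allA₁      = Fin.suc (Fin.suc Fin.zero)
pattern allC       = Fin.suc (Fin.suc (Fin.suc Fin.zero))
pattern avoiding b = Fin.suc (Fin.suc (Fin.suc (Fin.suc b)))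

Lower : Q → Set
Lower x = x ≡ after ⊎ x ≡ allA₁

data Step : Q → Sym → Q → Q → Set where
  stay    : Step before c before allC
  branch  : ∀ {x} b → Lower x → Step before c x (avoiding b)
  descend : ∀ {x} → Lower x → Step after c x allC
  all-a₁  : Step allA₁ a₁ allA₁ allA₁
  all-c   : Step allC c allC allC
  avoid   : ∀ {σ} b → σ ≢ forbidden b → Step (avoiding b) σ (avoiding b) (avoiding b)

lower? : ∀ x → Dec (Lower x)
lower? x = x ≟ after ⊎-dec x ≟ allA₁

step? : ∀ q σ x y → Dec (Step q σ x y)
step? before c x allC = map′ (λ { refl → stay }) (λ { stay → refl }) (x ≟ before)
step? before c x (avoiding b) = map′ (branch b) (λ { (branch _ lx) → lx }) (lower? x)
step? before c _ before = no λ ()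
step? before c _ after  = no λ ()
step? before c _ allA₁  = no λ ()
step? after c x y =
  map′ (λ { (lx , refl) → descend lx }) (λ { (descend lx) → lx , refl })
       (lower? x ×-dec y ≟ allC)
step? allA₁ a₁ x y =
  map′ (λ { (refl , refl) → all-a₁ }) (λ { all-a₁ → refl , refl })
       (x ≟ allA₁ ×-dec y ≟ allA₁)
step? allC c x y =
  map′ (λ { (refl , refl) → all-c }) (λ { all-c → refl , refl })
       (x ≟ allC ×-dec y ≟ allC)
step? (avoiding b) σ x y =
  map′ (λ { (σ≢ , refl , refl) → avoid b σ≢ }) (λ { (avoid _ σ≢) → σ≢ , refl , refl })
       (¬? (σ ≟ₛ forbidden b) ×-dec x ≟ avoiding b ×-dec y ≟ avoiding b)
step? before a₁ _ _ = no λ ()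
step? before a₂ _ _ = no λ ()
step? after  a₁ _ _ = no λ ()
step? after  a₂ _ _ = no λ ()
step? allA₁  c  _ _ = no λ ()
step? allA₁  a₂ _ _ = no λ ()
step? allC   a₁ _ _ = no λ ()
step? allC   a₂ _ _ = no λ ()

priority : Q → ℕ
priority before = 1
priority after  = 1
priority _      = 0

𝒜 : PTA
𝒜 = record
  { nQ     = 6
  ; QI     = λ q → does (q ≟ before)
  ; δ      = λ q σ x y → does (step? q σ x y)
  ; colour = priority
  }

ValidRun : Tree Sym → Tree Q → Set
ValidRun t φ = ∀ v → Step (φ v) (t v) (φ (v ++ [ l ])) (φ (v ++ [ r ]))

computation⇒valid : ∀ {t φ} → IsComputation 𝒜 t φ → φ [] ≡ before × ValidRun t φ
computation⇒valid {t} {φ} (init , steps) =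
  does⇒ (φ [] ≟ before) init ,
  λ v → does⇒ (step? (φ v) (t v) (φ (v ++ [ l ])) (φ (v ++ [ r ]))) (steps v)

valid⇒computation : ∀ {t φ} → φ [] ≡ before → ValidRun t φ → IsComputation 𝒜 t φ
valid⇒computation {t} {φ} init valid =
  dec-true (φ [] ≟ before) init ,
  λ v → dec-true (step? (φ v) (t v) (φ (v ++ [ l ])) (φ (v ++ [ r ]))) (valid v)

valid-child : ∀ {t φ} → ValidRun t φ → ∀ d → ValidRun (t ∘ (d ∷_)) (φ ∘ (d ∷_))
valid-child valid d v = valid (d ∷ v)

step-at-root : ∀ {t φ q} → ValidRun t φ → φ [] ≡ q → Step q (t []) (φ [ l ]) (φ [ r ])
step-at-root valid refl = valid []

before-inv : ∀ {σ x y} → Step before σ x y →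
  σ ≡ c × (x ≡ before × y ≡ allC ⊎ Lower x × ∃ λ b → y ≡ avoiding b)
before-inv stay          = refl , inj₁ (refl , refl)
before-inv (branch b lx) = refl , inj₂ (lx , b , refl)

after-inv : ∀ {σ x y} → Step after σ x y → σ ≡ c × Lower x × y ≡ allC
after-inv (descend lx) = refl , lx , refl

Sink : Q → (Sym → Set) → Set
Sink q P = ∀ {σ x y} → Step q σ x y → P σ × x ≡ q × y ≡ q

sink-a₁ : Sink allA₁ (_≡ a₁)
sink-a₁ all-a₁ = refl , refl , refl

sink-c : Sink allC (_≡ c)
sink-c all-c = refl , refl , refl

sink-avoiding : ∀ b → Sink (avoiding b) (_≢ forbidden b)
sink-avoiding b (avoid _ σ≢) = σ≢ , refl , refl

sink-run : ∀ {q P t φ} → Sink q P → ValidRun t φ → φ [] ≡ q →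
  ∀ w → φ w ≡ q × P (t w)
sink-run sink valid root w with sink (step-at-root valid root)
sink-run sink valid root []      | Pσ , _ , _ = root , Pσ
sink-run sink valid root (l ∷ w) | _ , left , _ = sink-run sink (valid-child valid l) left w
sink-run sink valid root (r ∷ w) | _ , _ , right = sink-run sink (valid-child valid r) right w

a₁-at : ℕ → Tree Sym
a₁-at m = graft (const-tree c) (lm m) (const-tree a₁)

grafted : ℕ → ℕ → Tree Sym → Tree Sym
grafted k m t′ = graft (graft (const-tree c) (lkr k) t′) (lm m) (const-tree a₁)

lower-run : ℕ → Tree Q
lower-run zero    _       = allA₁
lower-run (suc m) []      = after
lower-run (suc m) (l ∷ w) = lower-run m w
lower-run (suc m) (r ∷ w) = allC

run : ℕ → ℕ → Fin 2 → Tree Q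
run _       zero    _ _       = allA₁
run _       (suc m) _ []      = before
run zero    (suc m) _ (l ∷ w) = lower-run m w
run zero    (suc m) b (r ∷ w) = avoiding b
run (suc k) (suc m) b (l ∷ w) = run k m b w
run (suc k) (suc m) _ (r ∷ w) = allC

lower-run-root : ∀ m → Lower (lower-run m [])
lower-run-root zero    = inj₂ refl
lower-run-root (suc m) = inj₁ refl

lower-run-valid : ∀ m → ValidRun (a₁-at m) (lower-run m)
lower-run-valid zero    _       = all-a₁
lower-run-valid (suc m) []      = descend (lower-run-root m)
lower-run-valid (suc m) (l ∷ w) = lower-run-valid m w
lower-run-valid (suc m) (r ∷ w) = all-c

run-valid : ∀ {k m b t′} → k < m → Avoids b t′ → ValidRun (grafted k m t′) (run k m b)
run-valid {zero}  {suc m} {b} _ _ []      = branch b (lower-run-root m)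
run-valid {zero}  {suc m}     _ _ (l ∷ w) = lower-run-valid m w
run-valid {zero}  {suc m} {b} _ av (r ∷ w) = avoid b (av w)
run-valid {suc k} {suc zero} (s≤s ()) _ []
run-valid {suc k} {suc (suc m)} _ _ [] = stay
run-valid {suc k} {suc m} (s≤s k<m) av (l ∷ w) = run-valid k<m av w
run-valid {suc k} {suc m} _ _ (r ∷ w) = all-c

lower-run-deep : ∀ m v → m ≤ length v → priority (lower-run m v) ≡ 0
lower-run-deep zero    _       _       = refl
lower-run-deep (suc m) (l ∷ w) (s≤s p) = lower-run-deep m w p
lower-run-deep (suc m) (r ∷ w) _       = refl

run-deep : ∀ k m b v → m ≤ length v → priority (run k m b v) ≡ 0
run-deep _       zero    _ _       _       = refl
run-deep zero    (suc m) _ (l ∷ w) (s≤s p) = lower-run-deep m w p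
run-deep zero    (suc m) _ (r ∷ w) _       = refl
run-deep (suc k) (suc m) b (l ∷ w) (s≤s p) = run-deep k m b w p
run-deep (suc k) (suc m) _ (r ∷ w) _       = refl

run-accepting : ∀ {k m b t′} → k < m → Avoids b t′ → Accepting 𝒜 (grafted k m t′) (run k m b)
run-accepting {m = suc m} k<m av =
  valid⇒computation refl (run-valid k<m av) ,
  colour-eventually-0⇒parity 𝒜 (suc m) (λ v → run-deep _ (suc m) _ v)

¬even-before : ¬ Even 𝒜 (priority before)
¬even-before ()

¬even-after : ¬ Even 𝒜 (priority after)
¬even-after ()

record Shape (t : Tree Sym) (φ : Tree Q) : Set where
  constructor shape
  field
    k m    : ℕ
    b      : Fin 2
    k<m    : k < m
    t′     : Tree Sym
    avoids : Avoids b t′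
    tree≈  : t ≈T grafted k m t′
    run≈   : φ ≈T run k m b

lower-shape : ∀ n {t φ} → ValidRun t φ → Lower (φ []) → Even 𝒜 (priority (φ (lm n))) →
  ∃ λ m → φ ≈T lower-run m × t ≈T a₁-at m
lower-shape _ valid (inj₂ root) _ =
  let all = sink-run sink-a₁ valid root in 0 , proj₁ ∘ all , proj₂ ∘ all
lower-shape zero valid (inj₁ root) even =
  ⊥-elim (¬even-after (subst (Even 𝒜 ∘ priority) root even))
lower-shape (suc n) valid (inj₁ root) even =
  let c-root , left , right-allC = after-inv (step-at-root valid root)
      m , φ≈ , t≈ = lower-shape n (valid-child valid l) left even
      right = sink-run sink-c (valid-child valid r) right-allC
  in suc m , ≈T-node root φ≈ (proj₁ ∘ right) , ≈T-node c-root t≈ (proj₂ ∘ right)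

before-shape : ∀ n {t φ} → ValidRun t φ → φ [] ≡ before → Even 𝒜 (priority (φ (lm n))) →
  Shape t φ
before-shape zero valid root even =
  ⊥-elim (¬even-before (subst (Even 𝒜 ∘ priority) root even))
before-shape (suc n) {t} valid root even with before-inv (step-at-root valid root)
... | c-root , inj₁ (left , right-allC) =
  let shape k m b k<m t′ av t≈ φ≈ = before-shape n (valid-child valid l) left even
      right = sink-run sink-c (valid-child valid r) right-allC
  in shape (suc k) (suc m) b (s≤s k<m) t′ av
       (≈T-node c-root t≈ (proj₂ ∘ right)) (≈T-node root φ≈ (proj₁ ∘ right))
... | c-root , inj₂ (left , b , right-avoiding) =
  let m , φ≈ , t≈ = lower-shape n (valid-child valid l) left even
      right = sink-run (sink-avoiding b) (valid-child valid r) right-avoiding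
  in shape zero (suc m) b (s≤s z≤n) (t ∘ (r ∷_)) (proj₂ ∘ right)
       (≈T-node c-root t≈ (λ _ → refl)) (≈T-node root φ≈ (proj₁ ∘ right))

accepting-shape : ∀ {t φ} → Accepting 𝒜 t φ → Shape t φ
accepting-shape {t} {φ} accepting@(computation , _) =
  let root , valid = computation⇒valid computation
      n , even = accepting⇒even-on-left-spine 𝒜 {t} {φ} accepting
  in before-shape n valid root even

a₁-at-a₁ : ∀ m → a₁-at m (lm m) ≡ a₁
a₁-at-a₁ zero    = refl
a₁-at-a₁ (suc m) = a₁-at-a₁ m

a₁-at-c : ∀ {m j} → j < m → a₁-at m (lm j) ≡ c
a₁-at-c {suc m} {zero}  _         = refl
a₁-at-c {suc m} {suc j} (s≤s j<m) = a₁-at-c j<m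

grafted-a₁ : ∀ {k m} t′ → k < m → grafted k m t′ (lm m) ≡ a₁
grafted-a₁ {zero}  {suc m} _  _         = a₁-at-a₁ m
grafted-a₁ {suc k} {suc m} t′ (s≤s k<m) = grafted-a₁ t′ k<m

grafted-c : ∀ {k m j} t′ → k < m → j < m → grafted k m t′ (lm j) ≡ c
grafted-c {zero}  {suc m} {zero}  _  _         _         = refl
grafted-c {suc k} {suc m} {zero}  _  _         _         = refl
grafted-c {zero}  {suc m} {suc j} _  _         (s≤s j<m) = a₁-at-c j<m
grafted-c {suc k} {suc m} {suc j} t′ (s≤s k<m) (s≤s j<m) = grafted-c t′ k<m j<m

module _ {t : Tree Sym} where
  open Shape

  ¬shallower : ∀ {φ φ′} (S : Shape t φ) (S′ : Shape t φ′) → ¬ m S < m S′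
  ¬shallower S S′ m<m′ = a₁≢c (begin
    a₁                                       ≡⟨ sym (grafted-a₁ (t′ S) (k<m S)) ⟩
    grafted (k S) (m S) (t′ S) (lm (m S))    ≡⟨ sym (tree≈ S _) ⟩
    t (lm (m S))                             ≡⟨ tree≈ S′ _ ⟩
    grafted (k S′) (m S′) (t′ S′) (lm (m S)) ≡⟨ grafted-c (t′ S′) (k<m S′) m<m′ ⟩
    c                                        ∎)
    where open ≡-Reasoning

  m-unique : ∀ {φ φ′} (S : Shape t φ) (S′ : Shape t φ′) → m S ≡ m S′
  m-unique S S′ = ≤-antisym (≮⇒≥ (¬shallower S′ S)) (≮⇒≥ (¬shallower S S′))

  same-guesses⇒≈ : ∀ {φ φ′} (S : Shape t φ) (S′ : Shape t φ′) →
    k S ≡ k S′ → b S ≡ b S′ → φ ≈T φ′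
  same-guesses⇒≈ {φ} {φ′} S S′ k≡ b≡ v = begin
    φ v                          ≡⟨ run≈ S v ⟩
    run (k S) (m S) (b S) v      ≡⟨ cong₂ (λ k m → run k m (b S) v) k≡ (m-unique S S′) ⟩
    run (k S′) (m S′) (b S) v    ≡⟨ cong (λ b → run (k S′) (m S′) b v) b≡ ⟩
    run (k S′) (m S′) (b S′) v   ≡⟨ sym (run≈ S′ v) ⟩
    φ′ v                         ∎
    where open ≡-Reasoning

  guesses : ∀ {φ₀ φ} (S₀ : Shape t φ₀) → Shape t φ → Fin (m S₀ * 2)
  guesses S₀ S = combine (fromℕ< (subst (k S <_) (m-unique S S₀) (k<m S))) (b S)

  guesses-injective : ∀ {φ₀ φ φ′} (S₀ : Shape t φ₀) (S : Shape t φ) (S′ : Shape t φ′) →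
    guesses S₀ S ≡ guesses S₀ S′ → k S ≡ k S′ × b S ≡ b S′
  guesses-injective S₀ S S′ same =
    let k-bound≡ , b≡ = combine-injective {m S₀} _ (b S) _ (b S′) same
    in trans (sym (toℕ-fromℕ< _)) (trans (cong toℕ k-bound≡) (toℕ-fromℕ< _)) , b≡

finitely-ambiguous : FinitelyAmbiguous 𝒜
finitely-ambiguous t (φ , accepting , apart) =
  let S : ∀ i → Shape t (φ i)
      S i = accepting-shape (accepting i)
      i , j , i≢j , same = pigeonholeℕ (guesses (S 0) ∘ S)
      k≡ , b≡ = guesses-injective (S 0) (S i) (S j) same
  in apart i j i≢j (same-guesses⇒≈ (S i) (S j) k≡ b≡)

accepted⇒Lfa : ∀ t → Accepts 𝒜 t → Lfa t
accepted⇒Lfa t (φ , accepting) =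
  let shape k m b k<m t′ av t≈ _ = accepting-shape {t} {φ} accepting
  in m , k , k<m , t′ , Equivalence.from L¬a₁∨¬a₂⇔avoids (b , av) , t≈

Lfa⇒accepted : ∀ t → Lfa t → Accepts 𝒜 t
Lfa⇒accepted t (m , k , k<m , t′ , t′∈L , t≈) =
  let b , av = Equivalence.to L¬a₁∨¬a₂⇔avoids t′∈L
  in run k m b , accepting-resp-≈ 𝒜 {φ = run k m b} t≈ (run-accepting k<m av)

lemma6p3 : Σ PTA λ 𝒜 → FinitelyAmbiguous 𝒜 × (∀ t → Accepts 𝒜 t ⇔ Lfa t)
lemma6p3 = 𝒜 , finitely-ambiguous , λ t → mk⇔ (accepted⇒Lfa t) (Lfa⇒accepted t)
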